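{- Let $T$ be a non-trivial tree rooted in a central vertex $c$ of $T$. If $v\in V(T)$ and $v\neq c$, then the height of the subtree rooted in $v$ equals $\operatorname{reach}(C_2(v))$; if $v=c$, it equals $\operatorname{reach}(C_1(c))$.
   Context: The eccentricity of $v$ is $e(v)=\max\{d(v,u)\mid u\in V(T)\}$, the radius is $\operatorname{rad}(T)=\min_v e(v)$, and a central vertex is a vertex with $e(v)=\operatorname{rad}(T)$. In the tree rooted at $c$, the parent of $v\ne c$ is its neighbour closer to $c$; descendants of $v$ are the vertices other than $v$ in the subtree rooted at $v$ (those whose path to $c$ passes through $v$), and the height of the subtree rooted in $v$ is the maximum distance from $v$ to a vertex of that subtree. For a vertex $v$, the components of $T-\{v\}$ are its maximal connected subgraphs; for such a component $C(v)$, $\operatorname{reach}(C(v))=\max\{d(v,u)\mid u\in V(C(v))\cup\{v\}\}$. The components of $T-\{v\}$ are denoted $C_1(v),\dots,C_{\deg(v)}(v)$ so that $\operatorname{reach}(C_i(v))\ge\operatorname{reach}(C_{i+1}(v))$ for all $i$. Convention: if $T-\{v\}$ has fewer than $k$ components, $\operatorname{reach}(C_k(v))$ is taken to be $0$. -}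

module Defs where

open import Data.Nat using (ℕ; zero; suc; _≤_)
open import Data.Fin using (Fin)
open import Data.List using (List; []; _∷_)
open import Data.List.Membership.Propositional using (_∈_; _∉_)
open import Data.List.Relation.Unary.All using (All)
open import Data.List.Relation.Unary.Any using (Any)
open import Data.List.Relation.Unary.AllPairs using (AllPairs)
open import Data.List.Relation.Unary.Unique.Propositional using (Unique)
open import Data.Product using (Σ; ∃; ∃-syntax; _×_; _,_; proj₁; proj₂)
open import Data.Sum using (_⊎_)
open import Data.Empty using (⊥)
open import Relation.Nullary using (¬_)
open import Relation.Binary.PropositionalEquality using (_≡_; _≢_)

record Graph (n : ℕ) : Set₁ where
  field
    Adj    : Fin n → Fin n → Set
    sym    : ∀ {u v} → Adj u v → Adj v u
    irrefl : ∀ {u} → ¬ Adj u u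

module _ {n : ℕ} (G : Graph n) where
  open Graph G

  data Walk : Fin n → Fin n → Set where
    nil  : ∀ {u} → Walk u u
    cons : ∀ {u w v} → Adj u w → Walk w v → Walk u v

  len : ∀ {u v} → Walk u v → ℕ
  len nil        = 0
  len (cons _ p) = suc (len p)

  verts : ∀ {u v} → Walk u v → List (Fin n)
  verts {u} nil        = u ∷ []
  verts {u} (cons _ p) = u ∷ verts p

  IsPath : ∀ {u v} → Walk u v → Set
  IsPath p = Unique (verts p)

  Connected : Set
  Connected = ∀ u v → Walk u v

  -- A cycle: a closed walk of length ≥ 3 whose vertices (start counted once) are distinct.
  IsCycle : ∀ {u} → Walk u u → Set
  IsCycle nil        = ⊥
  IsCycle (cons e p) = (2 ≤ len p) × Unique (verts p)

  Acyclic : Set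
  Acyclic = ∀ u (p : Walk u u) → ¬ IsCycle p

  IsTree : Set
  IsTree = Connected × Acyclic

  Dist : Fin n → Fin n → ℕ → Set
  Dist u v k = (Σ (Walk u v) λ p → len p ≡ k) × (∀ (p : Walk u v) → k ≤ len p)

  Ecc : Fin n → ℕ → Set
  Ecc v e = (∃[ u ] Dist v u e) × (∀ u k → Dist v u k → k ≤ e)

  Radius : ℕ → Set
  Radius r = (∃[ v ] Ecc v r) × (∀ v e → Ecc v e → r ≤ e)

  Central : Fin n → Set
  Central c = ∃[ r ] (Radius r × Ecc c r)

  Descendant : Fin n → Fin n → Fin n → Set
  Descendant c v u = (u ≢ v) × (∀ (p : Walk u c) → IsPath p → v ∈ verts p)

  InSubtree : Fin n → Fin n → Fin n → Set
  InSubtree c v u = (u ≡ v) ⊎ Descendant c v u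

  Height : Fin n → Fin n → ℕ → Set
  Height c v h = (∃[ u ] (InSubtree c v u × Dist v u h))
               × (∀ u k → InSubtree c v u → Dist v u k → k ≤ h)

  -- a and b are connected in T - {v}
  ConnAvoid : Fin n → Fin n → Fin n → Set
  ConnAvoid v a b = Σ (Walk a b) λ p → v ∉ verts p

  -- For w ≠ v, C(w) is the component of T - {v} containing w;
  -- reach(C(w)) = max { d(v,u) | u ∈ V(C(w)) ∪ {v} } = r
  Reach : Fin n → Fin n → ℕ → Set
  Reach v w r = (∃[ u ] (((u ≡ v) ⊎ ConnAvoid v w u) × Dist v u r))
              × (∀ u k → ((u ≡ v) ⊎ ConnAvoid v w u) → Dist v u k → k ≤ r)

  -- A list of pairs (representative w_i of C_i(v), reach(C_i(v))) enumerating
  -- all components of T - {v} exactly once, ordered by non-increasing reach.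
  SortedComponents : Fin n → List (Fin n × ℕ) → Set
  SortedComponents v cs =
      All (λ x → proj₁ x ≢ v) cs
    × All (λ x → Reach v (proj₁ x) (proj₂ x)) cs
    × AllPairs (λ x y → ¬ ConnAvoid v (proj₁ x) (proj₁ y)) cs
    × (∀ u → u ≢ v → Any (λ x → ConnAvoid v (proj₁ x) u) cs)
    × AllPairs (λ x y → proj₂ y ≤ proj₂ x) cs

-- reach of the k-th entry (1-indexed) of the list; 0 if there are fewer than k.
reachAt : ∀ {n} → ℕ → List (Fin n × ℕ) → ℕ
reachAt _               []       = 0
reachAt zero            (_ ∷ _)  = 0
reachAt (suc zero)      (x ∷ _)  = proj₂ x
reachAt (suc (suc k))   (_ ∷ xs) = reachAt (suc k) xs

ReachC : ∀ {n} (G : Graph n) → ℕ → Fin n → ℕ → Set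
ReachC G k v r = ∃[ cs ] (SortedComponents G v cs × reachAt k cs ≡ r)

-- A vertex v ≠ c splits T into components, exactly one of which contains the
-- centre c; the subtree of v is v together with all the other components.  A
-- component C avoiding c has reach(C) < e(c): the path from c into C passes
-- through v, so e(c) ≥ d(c,v) + reach(C) > reach(C).  Since e(v) = reach(C₁(v))
-- ≥ rad = e(c), the first component is the one containing c, and the height of
-- the subtree is the largest remaining reach, reach(C₂(v)).  For v = c the
-- subtree is all of T and its height is e(c) = reach(C₁(c)).
{-# OPTIONS --safe #-}
module Submission where

open import Defs
open import Data.Nat using (ℕ; suc; _≤_; _+_; z≤n; s≤s)
open import Data.Nat.Properties
  using (≤-trans; ≤-decTotalOrder; +-mono-≤; m≤n+m; m≤n⇒m≤1+n; suc-injective; n≮n; module ≤-Reasoning)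
open import Data.Fin using (Fin; _≟_)
open import Data.List using (List; []; _∷_; length; map; filter; deduplicate; allFin)
open import Data.List.Membership.Propositional using (_∈_; find)
open import Data.List.Membership.Propositional.Properties using (∈-allFin; ∈-filter⁺)
open import Data.List.Relation.Unary.All as All using (All; []; _∷_)
open import Data.List.Relation.Unary.All.Properties as All using (all-filter; anti-mono; All¬⇒¬Any)
open import Data.List.Relation.Unary.Any as Any using (Any; here; there)
open import Data.List.Relation.Unary.Any.Properties as Any using ()
open import Data.List.Relation.Unary.AllPairs as AllPairs using (AllPairs; []; _∷_)
open import Data.List.Relation.Unary.AllPairs.Properties as AllPairs using ()
open import Data.List.Relation.Unary.Sorted.TotalOrder.Properties using (Sorted⇒AllPairs)
open import Data.List.Relation.Binary.Permutation.Propositional using (_↭_; ↭-sym; ↭⇒↭ₛ)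
open import Data.List.Relation.Binary.Permutation.Propositional.Properties using (All-resp-↭; Any-resp-↭)
import Data.List.Relation.Binary.Permutation.Setoid.Properties as Permutationₛ
import Data.List.Sort as Sort
open import Data.List.Extrema.Nat using (argmax; argmax-all; f[xs]≤f[argmax])
open import Data.Product using (∃-syntax; ∃₂; _×_; _,_; proj₁; proj₂)
open import Data.Sum as Sum using (_⊎_; inj₁; inj₂)
open import Data.Empty using (⊥-elim)
open import Function using (_∘_)
open import Relation.Binary using (Decidable; DecTotalOrder)
import Relation.Unary as U
import Relation.Binary.Construct.On as On
import Relation.Binary.Construct.Flip.EqAndOrd as Flip
open import Relation.Nullary using (¬_; yes; no; ¬?)
open import Relation.Nullary.Decidable using (_⊎-dec_; decidable-stable)
open import Relation.Binary.PropositionalEquality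
  using (_≡_; _≢_; refl; sym; cong; subst; setoid; resp₂; module ≡-Reasoning)

module Walks {n : ℕ} (G : Graph n) where
  open Graph G using () renaming (sym to Adj-sym)
  open import Data.List.Membership.DecPropositional (_≟_ {n}) using (_∈?_) public

  infixr 5 _++ʷ_
  _++ʷ_ : ∀ {a b c} → Walk G a b → Walk G b c → Walk G a c
  nil      ++ʷ q = q
  cons e p ++ʷ q = cons e (p ++ʷ q)

  reverseʷ : ∀ {a b} → Walk G a b → Walk G b a
  reverseʷ nil        = nil
  reverseʷ (cons e p) = reverseʷ p ++ʷ cons (Adj-sym e) nil

  len-++ʷ : ∀ {a b c} (p : Walk G a b) (q : Walk G b c) → len G (p ++ʷ q) ≡ len G p + len G q
  len-++ʷ nil        q = refl
  len-++ʷ (cons e p) q = cong suc (len-++ʷ p q)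

  length-verts : ∀ {a b} (p : Walk G a b) → length (verts G p) ≡ suc (len G p)
  length-verts nil        = refl
  length-verts (cons e p) = cong suc (length-verts p)

  start∈verts : ∀ {a b} (p : Walk G a b) → a ∈ verts G p
  start∈verts nil        = here refl
  start∈verts (cons e p) = here refl

  end∈verts : ∀ {a b} (p : Walk G a b) → b ∈ verts G p
  end∈verts nil        = here refl
  end∈verts (cons e p) = there (end∈verts p)

  ∈-verts-++ʷ⁺ˡ : ∀ {a b c x} (p : Walk G a b) (q : Walk G b c) → x ∈ verts G p → x ∈ verts G (p ++ʷ q)
  ∈-verts-++ʷ⁺ˡ nil        q (here refl) = start∈verts q
  ∈-verts-++ʷ⁺ˡ (cons e p) q (here x≡a)  = here x≡a
  ∈-verts-++ʷ⁺ˡ (cons e p) q (there x∈p) = there (∈-verts-++ʷ⁺ˡ p q x∈p)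

  ∈-verts-++ʷ⁺ʳ : ∀ {a b c x} (p : Walk G a b) (q : Walk G b c) → x ∈ verts G q → x ∈ verts G (p ++ʷ q)
  ∈-verts-++ʷ⁺ʳ nil        q x∈q = x∈q
  ∈-verts-++ʷ⁺ʳ (cons e p) q x∈q = there (∈-verts-++ʷ⁺ʳ p q x∈q)

  ∈-verts-++ʷ⁻ : ∀ {a b c x} (p : Walk G a b) (q : Walk G b c) →
                 x ∈ verts G (p ++ʷ q) → x ∈ verts G p ⊎ x ∈ verts G q
  ∈-verts-++ʷ⁻ nil        q x∈q          = inj₂ x∈q
  ∈-verts-++ʷ⁻ (cons e p) q (here x≡a)   = inj₁ (here x≡a)
  ∈-verts-++ʷ⁻ (cons e p) q (there x∈pq) = Sum.map₁ there (∈-verts-++ʷ⁻ p q x∈pq)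

  ∈-verts-reverseʷ⁻ : ∀ {a b x} (p : Walk G a b) → x ∈ verts G (reverseʷ p) → x ∈ verts G p
  ∈-verts-reverseʷ⁻ nil        x∈p = x∈p
  ∈-verts-reverseʷ⁻ (cons e p) x∈p with ∈-verts-++ʷ⁻ (reverseʷ p) (cons (Adj-sym e) nil) x∈p
  ... | inj₁ x∈p′                = there (∈-verts-reverseʷ⁻ p x∈p′)
  ... | inj₂ (here refl)         = there (start∈verts p)
  ... | inj₂ (there (here refl)) = here refl

  IsPath-++ʷ⁻ˡ : ∀ {a b c} (p : Walk G a b) (q : Walk G b c) → IsPath G (p ++ʷ q) → IsPath G p
  IsPath-++ʷ⁻ˡ nil        q _           = [] ∷ []
  IsPath-++ʷ⁻ˡ (cons e p) q (a∉pq ∷ pq!) = anti-mono (∈-verts-++ʷ⁺ˡ p q) a∉pq ∷ IsPath-++ʷ⁻ˡ p q pq!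

  IsPath-++ʷ⁻ʳ : ∀ {a b c} (p : Walk G a b) (q : Walk G b c) → IsPath G (p ++ʷ q) → IsPath G q
  IsPath-++ʷ⁻ʳ nil        q q!       = q!
  IsPath-++ʷ⁻ʳ (cons e p) q (_ ∷ pq!) = IsPath-++ʷ⁻ʳ p q pq!

  splitAt : ∀ {a b x} (p : Walk G a b) → x ∈ verts G p → ∃₂ λ (p₁ : Walk G a x) (p₂ : Walk G x b) → p ≡ p₁ ++ʷ p₂
  splitAt nil        (here refl) = nil , nil , refl
  splitAt (cons e p) (here refl) = nil , cons e p , refl
  splitAt (cons e p) (there x∈p) with splitAt p x∈p
  ... | p₁ , p₂ , refl = cons e p₁ , p₂ , refl

  record Shortcut {a b} (w : Walk G a b) : Set where
    field
      path   : Walk G a b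
      isPath : IsPath G path
      len≤   : len G path ≤ len G w
      verts⊆ : ∀ {x} → x ∈ verts G path → x ∈ verts G w

  -- Cut out the closed detour whenever the first vertex reappears further on.
  shortcut : ∀ {a b} (w : Walk G a b) → Shortcut w
  shortcut nil = record { path = nil ; isPath = [] ∷ [] ; len≤ = z≤n ; verts⊆ = λ x∈ → x∈ }
  shortcut (cons {a} e w) with shortcut w
  ... | record { path = p ; isPath = p! ; len≤ = p≤w ; verts⊆ = p⊆w } with a ∈? verts G p
  ...   | no a∉p = record
    { path   = cons e p
    ; isPath = All.¬Any⇒All¬ (verts G p) a∉p ∷ p!
    ; len≤   = s≤s p≤w
    ; verts⊆ = λ { (here x≡a) → here x≡a ; (there x∈p) → there (p⊆w x∈p) } }
  ...   | yes a∈p with splitAt p a∈p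
  ...     | p₁ , p₂ , refl = record
    { path   = p₂
    ; isPath = IsPath-++ʷ⁻ʳ p₁ p₂ p!
    ; len≤   = m≤n⇒m≤1+n (≤-trans (m≤n+m (len G p₂) (len G p₁))
                                   (subst (_≤ len G w) (len-++ʷ p₁ p₂) p≤w))
    ; verts⊆ = λ x∈p₂ → there (p⊆w (∈-verts-++ʷ⁺ʳ p₁ p₂ x∈p₂)) }

  dist-refl : ∀ {a} → Dist G a a 0
  dist-refl = (nil , refl) , λ _ → z≤n

  dist-through : ∀ {a b v k} → Dist G v b k → v ≢ a → (w : Walk G a b) → v ∈ verts G w → suc k ≤ len G w
  dist-through {v = v} {k} (_ , k≤) v≢a w v∈w with splitAt w v∈w
  ... | w₁ , w₂ , refl = begin
    1 + k               ≤⟨ +-mono-≤ (nonempty w₁ v≢a) (k≤ w₂) ⟩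
    len G w₁ + len G w₂ ≡⟨ len-++ʷ w₁ w₂ ⟨
    len G (w₁ ++ʷ w₂)   ∎
    where
      open ≤-Reasoning
      nonempty : ∀ {a} (p : Walk G a v) → v ≢ a → 1 ≤ len G p
      nonempty nil        v≢a = ⊥-elim (v≢a refl)
      nonempty (cons _ _) _   = s≤s z≤n

  connAvoid-refl : ∀ {v u} → u ≢ v → ConnAvoid G v u u
  connAvoid-refl u≢v = nil , λ { (here v≡u) → u≢v (sym v≡u) ; (there ()) }

  connAvoid-sym : ∀ {v a b} → ConnAvoid G v a b → ConnAvoid G v b a
  connAvoid-sym (p , v∉p) = reverseʷ p , v∉p ∘ ∈-verts-reverseʷ⁻ p

  connAvoid-trans : ∀ {v a b c} → ConnAvoid G v a b → ConnAvoid G v b c → ConnAvoid G v a c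
  connAvoid-trans (p , v∉p) (q , v∉q) = p ++ʷ q , Sum.[ v∉p , v∉q ] ∘ ∈-verts-++ʷ⁻ p q

  connAvoid⇒≢ : ∀ {v a b} → ConnAvoid G v a b → b ≢ v
  connAvoid⇒≢ (p , v∉p) refl = v∉p (end∈verts p)

  ¬connAvoid⇒∈verts : ∀ {v a b} → ¬ ConnAvoid G v a b → (w : Walk G a b) → v ∈ verts G w
  ¬connAvoid⇒∈verts {v} a↛b w = decidable-stable (v ∈? verts G w) (λ v∉w → a↛b (w , v∉w))

  connAvoid⇒Descendant : ∀ {c v w u} → ¬ ConnAvoid G v w c → ConnAvoid G v w u → Descendant G c v u
  connAvoid⇒Descendant w↛c w↝u =
    connAvoid⇒≢ w↝u , λ q _ → ¬connAvoid⇒∈verts (w↛c ∘ connAvoid-trans w↝u) q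

  Descendant⇒¬connAvoid : ∀ {c v u} → Descendant G c v u → ¬ ConnAvoid G v u c
  Descendant⇒¬connAvoid (_ , through) (w , v∉w) = v∉w (verts⊆ (through path isPath))
    where open Shortcut (shortcut w)

module ComponentLists {n : ℕ} (G : Graph n) (v : Fin n) where
  open Walks G

  Reaches : List (Fin n × ℕ) → Set
  Reaches = All (λ x → Reach G v (proj₁ x) (proj₂ x))

  Covers : List (Fin n × ℕ) → Fin n → Set
  Covers xs u = Any (λ x → ConnAvoid G v (proj₁ x) u) xs

  NonIncreasing : List (Fin n × ℕ) → Set
  NonIncreasing = AllPairs (λ x y → proj₂ y ≤ proj₂ x)

  reachAt1-attained : ∀ {xs} → Reaches xs → ∃[ u ] ((u ≡ v ⊎ Covers xs u) × Dist G v u (reachAt 1 xs))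
  reachAt1-attained []                                = v , inj₁ refl , dist-refl
  reachAt1-attained (((u , inj₁ u≡v , du) , _) ∷ _) = u , inj₁ u≡v , du
  reachAt1-attained (((u , inj₂ w↝u , du) , _) ∷ _) = u , inj₂ (here w↝u) , du

  reachAt1≤ : ∀ {xs : List (Fin n × ℕ)} {m} → All (λ x → proj₂ x ≤ m) xs → reachAt 1 xs ≤ m
  reachAt1≤ []          = z≤n
  reachAt1≤ (x≤m ∷ _) = x≤m

  reachAt1-maximal : ∀ {xs u k} → Reaches xs → NonIncreasing xs → u ≡ v ⊎ Covers xs u →
                     Dist G v u k → k ≤ reachAt 1 xs
  reachAt1-maximal _ _ (inj₁ refl) (_ , k≤) = ≤-trans (k≤ nil) z≤n
  reachAt1-maximal (ρ ∷ _) _ (inj₂ (here w↝u)) du = proj₂ ρ _ _ (inj₂ w↝u) du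
  reachAt1-maximal (_ ∷ ρs) (x≥xs ∷ ns) (inj₂ (there u∈xs)) du =
    ≤-trans (reachAt1-maximal ρs ns (inj₂ u∈xs) du) (reachAt1≤ x≥xs)

  Ecc-reachAt1 : ∀ {cs} → SortedComponents G v cs → Ecc G v (reachAt 1 cs)
  Ecc-reachAt1 {cs} (_ , ρs , _ , cover , ns) with reachAt1-attained ρs
  ... | u , _ , du = (u , du) , λ u′ _ → reachAt1-maximal ρs ns (vertex-or-covered u′)
    where
      vertex-or-covered : ∀ u → u ≡ v ⊎ Covers cs u
      vertex-or-covered u with u ≟ v
      ... | yes u≡v = inj₁ u≡v
      ... | no u≢v  = inj₂ (cover u u≢v)

  Height-below : ∀ {c x xs} → SortedComponents G v (x ∷ xs) → ConnAvoid G v (proj₁ x) c →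
                 Height G c v (reachAt 1 xs)
  Height-below {c} {xs = xs} (_ , _ ∷ ρs , x↛xs ∷ _ , cover , _ ∷ ns) x↝c =
    attained , λ u k → reachAt1-maximal ρs ns ∘ Sum.map₂ covered-by-xs
    where
      below : ∀ {u} → Covers xs u → Descendant G c v u
      below u∈xs with find u∈xs
      ... | y , y∈xs , y↝u =
        connAvoid⇒Descendant (All.lookup x↛xs y∈xs ∘ connAvoid-trans x↝c ∘ connAvoid-sym) y↝u

      attained : ∃[ u ] (InSubtree G c v u × Dist G v u (reachAt 1 xs))
      attained with reachAt1-attained ρs
      ... | u , here-or-xs , du = u , Sum.map₂ below here-or-xs , du

      covered-by-xs : ∀ {u} → Descendant G c v u → Covers xs u
      covered-by-xs desc with cover _ (proj₁ desc)
      ... | here x↝u   =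
        ⊥-elim (Descendant⇒¬connAvoid desc (connAvoid-trans (connAvoid-sym x↝u) x↝c))
      ... | there u∈xs = u∈xs

  Height-root : ∀ {h} → Ecc G v h → Height G v v h
  Height-root ((u , du) , maximal) = (u , inSubtree u , du) , λ u k _ → maximal u k
    where
      inSubtree : ∀ u → InSubtree G v v u
      inSubtree u with u ≟ v
      ... | yes u≡v = inj₁ u≡v
      ... | no u≢v  = inj₂ (u≢v , λ p _ → end∈verts p)

module Trees {n : ℕ} (T : Graph n) (connected : Connected T) (acyclic : Acyclic T) where
  open Graph T using (irrefl) renaming (sym to Adj-sym)
  open Walks T
  open ComponentLists T

  -- If the second vertex p of P lies on Q, the part of Q before p is a single
  -- edge (a longer one would close a cycle through the edge p–a); otherwise
  -- the edge p–a followed by Q is a second path from p to b, which by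
  -- induction has the vertices of the tail of P, and so a would occur twice on P.
  paths-unique : ∀ {a b} (P Q : Walk T a b) → IsPath T P → IsPath T Q → verts T P ≡ verts T Q
  paths-unique nil nil _ _ = refl
  paths-unique nil (cons _ Q) _ (a∉Q ∷ _) = ⊥-elim (All¬⇒¬Any a∉Q (end∈verts Q))
  paths-unique (cons {a} {p} e P) Q (a∉P ∷ P!) Q! with p ∈? verts T Q
  ... | no p∉Q = ⊥-elim (All¬⇒¬Any a∉P (subst (a ∈_) (sym P≡pQ) (there (start∈verts Q))))
    where
      P≡pQ : verts T P ≡ verts T (cons (Adj-sym e) Q)
      P≡pQ = paths-unique P (cons (Adj-sym e) Q) P! (All.¬Any⇒All¬ (verts T Q) p∉Q ∷ Q!)
  ... | yes p∈Q with splitAt Q p∈Q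
  ...   | nil , _ , refl = ⊥-elim (irrefl e)
  ...   | cons e′ nil , Q₂ , refl =
    cong (a ∷_) (paths-unique P Q₂ P! (IsPath-++ʷ⁻ʳ (cons e′ nil) Q₂ Q!))
  ...   | Q₁@(cons _ (cons _ _)) , Q₂ , refl =
    ⊥-elim (acyclic p (cons (Adj-sym e) Q₁) (s≤s (s≤s z≤n) , IsPath-++ʷ⁻ˡ Q₁ Q₂ Q!))

  paths-same-len : ∀ {a b} (P Q : Walk T a b) → IsPath T P → IsPath T Q → len T P ≡ len T Q
  paths-same-len P Q P! Q! = suc-injective (begin
    suc (len T P)      ≡⟨ length-verts P ⟨
    length (verts T P) ≡⟨ cong length (paths-unique P Q P! Q!) ⟩
    length (verts T Q) ≡⟨ length-verts Q ⟩
    suc (len T Q)      ∎)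
    where open ≡-Reasoning

  path : ∀ a b → Walk T a b
  path a b = Shortcut.path (shortcut (connected a b))

  path-isPath : ∀ a b → IsPath T (path a b)
  path-isPath a b = Shortcut.isPath (shortcut (connected a b))

  d : Fin n → Fin n → ℕ
  d a b = len T (path a b)

  dist : ∀ a b → Dist T a b (d a b)
  dist a b = (path a b , refl) , λ w →
    let open Shortcut (shortcut w) renaming (path to p; isPath to p!) in
    subst (_≤ len T w) (paths-same-len p (path a b) p! (path-isPath a b)) len≤

  connAvoid? : ∀ v → Decidable (ConnAvoid T v)
  connAvoid? v a b with v ∈? verts T (path a b)
  ... | no v∉path  = yes (path a b , v∉path)
  ... | yes v∈path = no λ (w , v∉w) →
    let open Shortcut (shortcut w) renaming (path to p; isPath to p!) in
    v∉w (verts⊆ (subst (v ∈_) (paths-unique (path a b) p (path-isPath a b) p!) v∈path))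

  InClosedComponent : Fin n → Fin n → Fin n → Set
  InClosedComponent v w u = u ≡ v ⊎ ConnAvoid T v w u

  inClosedComponent? : ∀ v w → U.Decidable (InClosedComponent v w)
  inClosedComponent? v w u = (u ≟ v) ⊎-dec connAvoid? v w u

  closedComponent : Fin n → Fin n → List (Fin n)
  closedComponent v w = filter (inClosedComponent? v w) (allFin n)

  farthest : Fin n → Fin n → Fin n
  farthest v w = argmax (d v) v (closedComponent v w)

  reachOf : Fin n → Fin n → ℕ
  reachOf v w = d v (farthest v w)

  reach : ∀ v w → Reach T v w (reachOf v w)
  reach v w =
      ( farthest v w
      , argmax-all (d v) {P = InClosedComponent v w} (inj₁ refl)
                   (all-filter (inClosedComponent? v w) (allFin n))
      , dist v _)
    , λ u k u∈C du → ≤-trans (proj₂ du (path v u)) (All.lookup (f[xs]≤f[argmax] v (closedComponent v w))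
                                                               (∈-filter⁺ (inClosedComponent? v w) (∈-allFin u) u∈C))

  components : Fin n → List (Fin n)
  components v = deduplicate (connAvoid? v) (filter (λ u → ¬? (u ≟ v)) (allFin n))

  components-≢ : ∀ v → All (_≢ v) (components v)
  components-≢ v = All.deduplicate⁺ (connAvoid? v) (all-filter (λ u → ¬? (u ≟ v)) (allFin n))

  components-separated : ∀ v → AllPairs (λ w w′ → ¬ ConnAvoid T v w w′) (components v)
  components-separated v = separated (filter (λ u → ¬? (u ≟ v)) (allFin n))
    where
      separated : ∀ us → AllPairs (λ w w′ → ¬ ConnAvoid T v w w′) (deduplicate (connAvoid? v) us)
      separated []       = []
      separated (u ∷ us) =
        all-filter (¬? ∘ connAvoid? v u) (deduplicate (connAvoid? v) us) ∷ AllPairs.filter⁺ _ (separated us)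

  components-cover : ∀ {v u} → u ≢ v → Any (λ w → ConnAvoid T v w u) (components v)
  components-cover {v} {u} u≢v =
    Any.deduplicate⁺ (connAvoid? v) connAvoid-trans
      (Any.map (λ { refl → connAvoid-refl u≢v }) (∈-filter⁺ (λ u → ¬? (u ≟ v)) (∈-allFin u) u≢v))

  byReach : Fin n → DecTotalOrder _ _ _
  byReach v = On.decTotalOrder (Flip.decTotalOrder ≤-decTotalOrder) (reachOf v)

  sortedComponents : Fin n → List (Fin n × ℕ)
  sortedComponents v = map (λ w → w , reachOf v w) (Sort.sort (byReach v) (components v))

  sortedComponents-correct : ∀ v → SortedComponents T v (sortedComponents v)
  sortedComponents-correct v =
      All.map⁺ (All-resp-↭ sorted↭ (components-≢ v))
    , All.map⁺ (All.universal (reach v) _)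
    , AllPairs.map⁺ (Permutationₛ.AllPairs-resp-↭ (setoid (Fin n)) (λ w↛w′ → w↛w′ ∘ connAvoid-sym) (resp₂ _)
                                                   (↭⇒↭ₛ sorted↭) (components-separated v))
    , (λ u u≢v → Any.map⁺ (Any-resp-↭ sorted↭ (components-cover u≢v)))
    , AllPairs.map⁺ (Sorted⇒AllPairs (DecTotalOrder.totalOrder (byReach v)) (Sort.sort-↗ (byReach v) (components v)))
    where
      sorted↭ : components v ↭ Sort.sort (byReach v) (components v)
      sorted↭ = ↭-sym (Sort.sort-↭ (byReach v) (components v))

  reach<ecc : ∀ {c r v w ρ} → Ecc T c r → v ≢ c → Reach T v w ρ → ¬ ConnAvoid T v w c → suc ρ ≤ r
  reach<ecc {c} {v = v} {w} (_ , ecc-maximal) v≢c ((u , u∈C , du) , _) w↛c =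
    ≤-trans (dist-through du v≢c (path c u) (¬connAvoid⇒∈verts (c↛ u∈C) (path c u)))
            (ecc-maximal u (d c u) (dist c u))
    where
      c↛ : ∀ {u} → InClosedComponent v w u → ¬ ConnAvoid T v c u
      c↛ (inj₁ refl) c↝v = connAvoid⇒≢ c↝v refl
      c↛ (inj₂ w↝u)  c↝u = w↛c (connAvoid-trans w↝u (connAvoid-sym c↝u))

  firstComponent∋centre : ∀ {c v x xs} → Central T c → v ≢ c → SortedComponents T v (x ∷ xs) →
                          ConnAvoid T v (proj₁ x) c
  firstComponent∋centre {c} {v} {x} (_ , (_ , radius-minimal) , ecc-c) v≢c sorted@(_ , ρ ∷ _ , _)
    with connAvoid? v (proj₁ x) c
  ... | yes x↝c = x↝c
  ... | no x↛c  = ⊥-elim (n≮n _ (≤-trans (reach<ecc ecc-c v≢c ρ x↛c)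
                                          (radius-minimal v _ (Ecc-reachAt1 v sorted))))

  Height-nonroot : ∀ {c v cs} → Central T c → v ≢ c → SortedComponents T v cs → Height T c v (reachAt 2 cs)
  Height-nonroot {c} {cs = []} _ v≢c (_ , _ , _ , cover , _) with cover c (v≢c ∘ sym)
  ... | ()
  Height-nonroot {cs = _ ∷ _} central v≢c sorted =
    Height-below _ sorted (firstComponent∋centre central v≢c sorted)

lemma3p4 : ∀ {n} (T : Graph n) → IsTree T → 2 ≤ n → (c : Fin n) → Central T c → (v : Fin n)
           → (v ≢ c → ∃[ h ] (Height T c v h × ReachC T 2 v h))
           × (v ≡ c → ∃[ h ] (Height T c v h × ReachC T 1 c h))
lemma3p4 {n} T (connected , acyclic) _ c central v =
    (λ v≢c → reachAt 2 cs , Height-nonroot central v≢c sorted , cs , sorted , refl)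
  , λ { refl → reachAt 1 cs , Height-root v (Ecc-reachAt1 v sorted) , cs , sorted , refl }
  where
    open Trees T connected acyclic
    open ComponentLists T
    cs : List (Fin n × ℕ)
    cs = sortedComponents v

    sorted : SortedComponents T v cs
    sorted = sortedComponents-correct v
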